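{- Let $G$ be a finite abelian $p$-group ($p$ prime) with exponent $q$, let $d=\lceil\mathsf D^*(G)/q\rceil$, and let $k_0\geq 1$ be an integer. Suppose $\mathsf s_{kq}(G)\leq kq+\mathsf D^*(G)-1$ for all integers $k\in[k_0,2k_0-1]$. Then $\mathsf s_{kq}(G)\leq kq+\mathsf D^*(G)-1$ for all integers $k\geq k_0$.
   Context: If $G\cong C_{n_1}\oplus\cdots\oplus C_{n_r}$ with $1\leq n_1\mid\cdots\mid n_r$ ($C_n$ cyclic of order $n$), then $\mathsf D^*(G)=1+\sum_{i=1}^r(n_i-1)$. A sequence over $G$ is a finite unordered list (multiset) of elements of $G$; it is zero-sum if its terms sum to $0$. For an integer $L\geq0$, $\mathsf s_L(G)$ is the minimal integer $\ell$ such that every sequence of $\ell$ terms from $G$ has a zero-sum subsequence of length exactly $L$. $[a,b]$ denotes integers $x$ with $a\leq x\leq b$. -}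

module Defs where

open import Data.Nat using (ℕ; zero; suc; _+_; _*_; _∸_; _^_; _≤_; _⊔_)
open import Data.Nat.Divisibility using (_∣_)
open import Data.Fin using (Fin; toℕ) renaming (zero to fzero; suc to fsuc)
open import Data.List using (List; length; map)
open import Data.Nat.ListAction using (sum)
open import Data.List.Relation.Binary.Sublist.Propositional using (_⊆_)
open import Data.Product using (Σ; ∃; _×_)
open import Relation.Binary.PropositionalEquality using (_≡_)

-- A finite abelian p-group is (up to isomorphism) G = C_{p^e_0} ⊕ ... ⊕ C_{p^e_{r-1}}.
-- It is given by p, r and the exponent vector e : Fin r → ℕ.

cyc : (p r : ℕ) → (Fin r → ℕ) → Fin r → ℕ
cyc p r e i = p ^ e i

Elem : (p r : ℕ) → (Fin r → ℕ) → Set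
Elem p r e = (i : Fin r) → Fin (cyc p r e i)

-- sequences over G (finite unordered lists; represented as lists,
-- subsequences as sublists)
Seq : (p r : ℕ) → (Fin r → ℕ) → Set
Seq p r e = List (Elem p r e)

ZeroSum : (p r : ℕ) (e : Fin r → ℕ) → Seq p r e → Set
ZeroSum p r e S = (i : Fin r) → cyc p r e i ∣ sum (map (λ g → toℕ (g i)) S)

ΣFin : (r : ℕ) → (Fin r → ℕ) → ℕ
ΣFin zero f = 0
ΣFin (suc r) f = f fzero + ΣFin r (λ i → f (fsuc i))

maxFin : (r : ℕ) → (Fin r → ℕ) → ℕ
maxFin zero f = 0
maxFin (suc r) f = f fzero ⊔ maxFin r (λ i → f (fsuc i))

Dstar : (p r : ℕ) → (Fin r → ℕ) → ℕ
Dstar p r e = 1 + ΣFin r (λ i → cyc p r e i ∸ 1)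

-- exponent q of G = max of the orders p^{e_i} (= p^{max e_i}; 1 for trivial G)
expo : (p r : ℕ) → (Fin r → ℕ) → ℕ
expo p r e = p ^ maxFin r e

HasZSOfLength : (p r : ℕ) (e : Fin r → ℕ) → ℕ → Seq p r e → Set
HasZSOfLength p r e L S = Σ (Seq p r e) λ T → T ⊆ S × length T ≡ L × ZeroSum p r e T

Good : (p r : ℕ) (e : Fin r → ℕ) → ℕ → ℕ → Set
Good p r e L ℓ = (S : Seq p r e) → length S ≡ ℓ → HasZSOfLength p r e L S

-- s_L(G) ≤ X : the minimum of {ℓ : Good L ℓ} exists and is ≤ X,
-- i.e. some ℓ ≤ X is Good
sLe : (p r : ℕ) (e : Fin r → ℕ) → ℕ → ℕ → Set
sLe p r e L X = ∃ λ ℓ → ℓ ≤ X × Good p r e L ℓ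

-- This property
-- is additive in L: take a zero-sum subsequence of length L₁, then one of length L₂ among
-- the remaining terms, and put them together.  Every k ≥ k₀ is a sum of k₀ and a smaller
-- number that is again ≥ k₀ or lies in the window, so strong induction finishes.
-- Neither the primality of p nor the value of the exponent q plays any role.
module Submission where

open import Defs
open import Data.Nat using (ℕ; _+_; _*_; _∸_; _≤_)
open import Data.Nat.Primality using (Prime)
open import Data.Fin using (Fin; toℕ)

open import Data.Nat using (suc; _<_; s≤s; z≤n; z<s; _≤?_)
open import Data.Nat.Properties
open import Data.Nat.Induction using (<-rec)
open import Data.Nat.Divisibility using (_∣_; ∣m∣n⇒∣m+n)
open import Data.Nat.ListAction using (sum)
open import Data.Nat.ListAction.Properties using (sum-++; sum-↭)
open import Data.List using (List; []; _∷_; _++_; length; map; take)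
open import Data.List.Properties using (length-++; length-take; map-++)
open import Data.List.Relation.Binary.Sublist.Propositional using (_⊆_; []; _∷_; _∷ʳ_; ⊆-trans)
open import Data.List.Relation.Binary.Sublist.Propositional.Properties using (take-⊆)
open import Data.List.Relation.Binary.Permutation.Propositional using (_↭_; prep; ↭-sym; ↭-trans)
open import Data.List.Relation.Binary.Permutation.Propositional.Properties
  using (↭-length; shift; map⁺)
open import Data.Product using (∃; _×_; _,_)
open import Relation.Binary.PropositionalEquality
open import Relation.Nullary using (yes; no)

module _ {A : Set} where

  complement : {xs ys : List A} → xs ⊆ ys → List A
  complement []       = []
  complement (y ∷ʳ τ) = y ∷ complement τ
  complement (_ ∷ τ)  = complement τ

  length-complement : {xs ys : List A} (τ : xs ⊆ ys) →
    length xs + length (complement τ) ≡ length ys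
  length-complement []            = refl
  length-complement {xs} (y ∷ʳ τ) = trans (+-suc (length xs) _) (cong suc (length-complement τ))
  length-complement (refl ∷ τ)    = cong suc (length-complement τ)

  ⊆-merge-complement : {xs ys zs : List A} (τ : xs ⊆ zs) → ys ⊆ complement τ →
    ∃ λ ws → ws ⊆ zs × ws ↭ xs ++ ys
  ⊆-merge-complement [] [] = [] , [] , _↭_.refl
  ⊆-merge-complement (y ∷ʳ τ) (.y ∷ʳ σ) with ⊆-merge-complement τ σ
  ... | ws , ws⊆zs , π = ws , y ∷ʳ ws⊆zs , π
  ⊆-merge-complement {xs} {_ ∷ ys} (y ∷ʳ τ) (refl ∷ σ) with ⊆-merge-complement τ σ
  ... | ws , ws⊆zs , π = y ∷ ws , refl ∷ ws⊆zs , ↭-trans (prep y π) (↭-sym (shift y xs ys))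
  ⊆-merge-complement (refl ∷ τ) σ with ⊆-merge-complement τ σ
  ... | ws , ws⊆zs , π = _ , refl ∷ ws⊆zs , prep _ π

module _ (p r : ℕ) (e : Fin r → ℕ) where

  coordinateSum : Fin r → Seq p r e → ℕ
  coordinateSum i S = sum (map (λ g → toℕ (g i)) S)

  ZeroSum-++ : (S T : Seq p r e) → ZeroSum p r e S → ZeroSum p r e T → ZeroSum p r e (S ++ T)
  ZeroSum-++ S T zS zT i = subst (cyc p r e i ∣_) (sym sum-split) (∣m∣n⇒∣m+n (zS i) (zT i))
    where
    sum-split : coordinateSum i (S ++ T) ≡ coordinateSum i S + coordinateSum i T
    sum-split = trans (cong sum (map-++ _ S T)) (sum-++ (map _ S) (map _ T))

  ZeroSum-↭ : {S T : Seq p r e} → S ↭ T → ZeroSum p r e T → ZeroSum p r e S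
  ZeroSum-↭ π zT i = subst (cyc p r e i ∣_) (sym (sum-↭ (map⁺ _ π))) (zT i)

  -- Upward-closed form of Good, so that no sequence has to be cut to an exact length.
  GoodFrom : ℕ → ℕ → Set
  GoodFrom L ℓ = (S : Seq p r e) → ℓ ≤ length S → HasZSOfLength p r e L S

  sLe⇒GoodFrom : ∀ {L X} → sLe p r e L X → GoodFrom L X
  sLe⇒GoodFrom (ℓ , ℓ≤X , good) S X≤∣S∣ with good (take ℓ S)
      (trans (length-take ℓ S) (m≤n⇒m⊓n≡m (≤-trans ℓ≤X X≤∣S∣)))
  ... | T , T⊆ , ∣T∣ , zT = T , ⊆-trans T⊆ (take-⊆ ℓ S) , ∣T∣ , zT

  GoodFrom⇒sLe : ∀ {L X} → GoodFrom L X → sLe p r e L X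
  GoodFrom⇒sLe good = _ , ≤-refl , λ S ∣S∣ → good S (≤-reflexive (sym ∣S∣))

  GoodFrom-+ : ∀ s L₁ L₂ → GoodFrom L₁ (L₁ + s) → GoodFrom L₂ (L₂ + s) →
    GoodFrom (L₁ + L₂) (L₁ + L₂ + s)
  GoodFrom-+ s L₁ L₂ good₁ good₂ S long with good₁ S (≤-trans (+-monoʳ-≤ L₁ (m≤n+m s L₂)) long′)
    where
    long′ : L₁ + (L₂ + s) ≤ length S
    long′ = subst (_≤ length S) (+-assoc L₁ L₂ s) long
  ... | T₁ , τ , refl , zT₁ with good₂ (complement τ) rest-long
    where
    rest-long : L₂ + s ≤ length (complement τ)
    rest-long = +-cancelˡ-≤ L₁ _ _
      (subst₂ _≤_ (+-assoc L₁ L₂ s) (sym (length-complement τ)) long)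
  ... | T₂ , σ , refl , zT₂ with ⊆-merge-complement τ σ
  ... | T , T⊆S , π =
    T , T⊆S , trans (↭-length π) (length-++ T₁) , ZeroSum-↭ π (ZeroSum-++ T₁ T₂ zT₁ zT₂)

additive-closure-from-window : (P : ℕ → Set) (k₀ : ℕ) → 1 ≤ k₀ →
  (∀ a b → P a → P b → P (a + b)) →
  (∀ k → k₀ ≤ k → k ≤ 2 * k₀ ∸ 1 → P k) →
  ∀ k → k₀ ≤ k → P k
additive-closure-from-window P k₀@(suc m) _ P-+ window = <-rec _ extend
  where
  P[k₀] : P k₀
  P[k₀] = window k₀ ≤-refl (suc[m]≤n⇒m≤pred[n] (m<m+n k₀ z<s))

  -- For k₀ = 1 + m, suc (2 * k₀ ∸ 1) computes to 2 * k₀ = k₀ + (k₀ + 0), so ≰⇒> needs no arithmetic.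
  extend : ∀ k → (∀ {j} → j < k → k₀ ≤ j → P j) → k₀ ≤ k → P k
  extend k smaller k₀≤k with k ≤? 2 * k₀ ∸ 1
  ... | yes in-window = window k k₀≤k in-window
  ... | no beyond with m≤n⇒∃[o]m+o≡n (subst (_≤ k) (cong (k₀ +_) (+-identityʳ k₀)) (≰⇒> beyond))
  ... | j , refl = subst P k₀+[k₀+j]≡k (P-+ k₀ (k₀ + j) P[k₀] (smaller k₀+j<k (m≤m+n k₀ j)))
    where
    k₀+[k₀+j]≡k : k₀ + (k₀ + j) ≡ k₀ + k₀ + j
    k₀+[k₀+j]≡k = sym (+-assoc k₀ k₀ j)
    k₀+j<k : k₀ + j < k₀ + k₀ + j
    k₀+j<k = subst (k₀ + j <_) k₀+[k₀+j]≡k (m<n+m (k₀ + j) z<s)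

lemma3p5 : (p : ℕ) → Prime p → (r : ℕ) → (e : Fin r → ℕ) → (k₀ : ℕ) → 1 ≤ k₀ →
    ((k : ℕ) → k₀ ≤ k → k ≤ 2 * k₀ ∸ 1 →
      sLe p r e (k * expo p r e) (k * expo p r e + Dstar p r e ∸ 1)) →
    (k : ℕ) → k₀ ≤ k →
      sLe p r e (k * expo p r e) (k * expo p r e + Dstar p r e ∸ 1)
lemma3p5 p _ r e k₀ 1≤k₀ window k k₀≤k =
  GoodFrom⇒sLe p r e (subst (GoodFrom p r e (k * q)) (sym (truncation-harmless k)) (P[k] k k₀≤k))
  where
  q = expo p r e
  s = Dstar p r e ∸ 1

  truncation-harmless : ∀ k → k * q + Dstar p r e ∸ 1 ≡ k * q + s
  truncation-harmless k = +-∸-assoc (k * q) (s≤s z≤n)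

  P : ℕ → Set
  P k = GoodFrom p r e (k * q) (k * q + s)

  P-+ : ∀ a b → P a → P b → P (a + b)
  P-+ a b Pa Pb = subst (λ L → GoodFrom p r e L (L + s)) (sym (*-distribʳ-+ q a b))
    (GoodFrom-+ p r e s (a * q) (b * q) Pa Pb)

  P[k] : ∀ k → k₀ ≤ k → P k
  P[k] = additive-closure-from-window P k₀ 1≤k₀ P-+ λ k lo hi →
    subst (GoodFrom p r e (k * q)) (truncation-harmless k) (sLe⇒GoodFrom p r e (window k lo hi))
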